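{- For fixed $\alpha,\beta>0$, Karp's minimum mean-cycle algorithm (applied to the graph with negated edge weights, so that it returns a cycle $C_K$ of maximum mean weight $\frac{1}{|C_K|}\sum_{e\in C_K}w(e)$) provides an $O(n)$-approximation for MSIC$[\alpha,\beta]$ in arbitrary digraphs with non-negative edge weights; that is, $F(C^*)/F(C_K)=O(n)$, where $C^*$ is an optimal solution of MSIC$[\alpha,\beta]$.
   Context: Let $G=(V,E)$ be a simple directed graph with $n=|V|$ nodes and non-negative edge weights $w$. A (simple) cycle is a closed walk along edges of $E$ with no repeated node except first = last; $|C|$ is its number of edges. For $\alpha,\beta>0$, $F(C)=\frac{\sum_{e\in C} w(e)}{\alpha|C|+n\beta}$. MSIC$[\alpha,\beta]$: find a simple cycle maximizing $F(C)$. Karp's algorithm computes, in $\Theta(nm)$ time with $m=|E|$, a cycle minimizing the mean edge weight in a digraph with real edge weights.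
   Formalization: The edge weights $w$ and the parameters $\alpha,\beta$ take rational values rather than real ones. -}

module Defs where

open import Data.Nat as ℕ using (ℕ; zero; suc)
open import Data.Nat.Coprimality using (1-coprimeTo; sym)
open import Data.Integer using (+_)
open import Data.Bool using (Bool; true; false)
open import Data.Fin using (Fin)
open import Data.List using (List; []; _∷_; zip; _++_; [_]; map; foldr)
open import Data.List.NonEmpty using (List⁺; _∷_; toList; length)
open import Data.List.Relation.Unary.All using (All)
open import Data.List.Relation.Unary.Unique.Propositional using (Unique)
open import Data.Product using (_×_; _,_; uncurry)
open import Relation.Binary.PropositionalEquality using (_≡_)
open import Data.Rational using (ℚ; mkℚ; 0ℚ; _+_; _*_; _÷_; _≤_; Positive; NonNegative)
open import Data.Rational.Properties using (pos*pos⇒pos; pos+nonNeg⇒pos; pos⇒nonNeg; nonNeg*nonNeg⇒nonNeg; pos⇒nonZero)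

ℕ→ℚ : ℕ → ℚ
ℕ→ℚ k = mkℚ (+ k) 0 (sym (1-coprimeTo k))

-- A simple directed graph on vertex set Fin n:
-- adjacency E u v ≡ true iff (u , v) is an edge; no self-loops.
-- (Multi-edges are impossible in this representation.)
Loopless : ∀ {n} → (Fin n → Fin n → Bool) → Set
Loopless {n} E = ∀ (v : Fin n) → E v v ≡ false

-- A cycle is given by its cyclic vertex sequence v₀ v₁ … v_{k-1};
-- its edges are (v₀,v₁), …, (v_{k-2},v_{k-1}), (v_{k-1},v₀).
cycleEdges : ∀ {n} → List⁺ (Fin n) → List (Fin n × Fin n)
cycleEdges (v ∷ vs) = zip (v ∷ vs) (vs ++ [ v ])

∣_∣ᶜ : ∀ {n} → List⁺ (Fin n) → ℕ
∣ C ∣ᶜ = length C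

IsSimpleCycle : ∀ {n} → (Fin n → Fin n → Bool) → List⁺ (Fin n) → Set
IsSimpleCycle E C = Unique (toList C) × All (λ e → uncurry E e ≡ true) (cycleEdges C)

sumℚ : List ℚ → ℚ
sumℚ = foldr _+_ 0ℚ

weight : ∀ {n} → (Fin n → Fin n → ℚ) → List⁺ (Fin n) → ℚ
weight w C = sumℚ (map (uncurry w) (cycleEdges C))

private
  len-pos : ∀ {n} (C : List⁺ (Fin n)) → Positive (ℕ→ℚ (length C))
  len-pos (v ∷ vs) = _

  nat-nonNeg : ∀ k → NonNegative (ℕ→ℚ k)
  nat-nonNeg k = _

mean : ∀ {n} → (Fin n → Fin n → ℚ) → List⁺ (Fin n) → ℚ
mean w C = _÷_ (weight w C) (ℕ→ℚ (length C)) {{pos⇒nonZero (ℕ→ℚ (length C)) {{len-pos C}}}}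

F : (α β : ℚ) → .{{Positive α}} → .{{Positive β}} →
    ∀ {n} → (Fin n → Fin n → ℚ) → List⁺ (Fin n) → ℚ
F α β {{pα}} {{pβ}} {n} w C =
  _÷_ (weight w C) (α * ℕ→ℚ (length C) + ℕ→ℚ n * β)
      {{pos⇒nonZero (α * ℕ→ℚ (length C) + ℕ→ℚ n * β) {{pos+nonNeg⇒pos (α * ℕ→ℚ (length C))
          {{pos*pos⇒pos α {{pα}} (ℕ→ℚ (length C)) {{len-pos C}}}}
          (ℕ→ℚ n * β)
          {{nonNeg*nonNeg⇒nonNeg (ℕ→ℚ n) {{nat-nonNeg n}} β {{pos⇒nonNeg β {{pβ}}}}}}}}}}

IsOptimalMSIC : (α β : ℚ) → .{{Positive α}} → .{{Positive β}} →
    ∀ {n} → (Fin n → Fin n → Bool) → (Fin n → Fin n → ℚ) → List⁺ (Fin n) → Set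
IsOptimalMSIC α β E w C =
  IsSimpleCycle E C × (∀ D → IsSimpleCycle E D → F α β w D ≤ F α β w C)

-- C is a maximum mean-weight (simple) cycle, i.e. a possible output of
-- Karp's algorithm run on the negated weights.
IsMaxMeanCycle : ∀ {n} → (Fin n → Fin n → Bool) → (Fin n → Fin n → ℚ) → List⁺ (Fin n) → Set
IsMaxMeanCycle E w C =
  IsSimpleCycle E C × (∀ D → IsSimpleCycle E D → mean w D ≤ mean w C)

{-# OPTIONS --safe #-}
-- Since α|C| ≤ α|C| + nβ ≤ (α + β) n |C| for n ≥ 1, every cycle satisfies
-- α F(C) ≤ mean(C) ≤ (α + β) n F(C).  Chaining these through mean(C*) ≤ mean(Cₖ)
-- gives F(C*) ≤ ((α + β) / α) n F(Cₖ).
module Submission where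

open import Defs
open import Data.Nat using (ℕ; _≥_; suc; s≤s; z≤n)
open import Data.Bool using (Bool)
open import Data.Fin using (Fin)
open import Data.Integer using (+≤+)
open import Data.List using ([]; _∷_; map)
open import Data.List.NonEmpty using (List⁺; _∷_; length)
open import Data.Product using (Σ; _,_; uncurry)
open import Data.Rational using (ℚ; 0ℚ; 1ℚ; _+_; _*_; _÷_; 1/_; _≤_; *≤*; Positive; nonNegative)
open import Data.Rational.Properties
open import Data.Rational.Solver using (module +-*-Solver)
open import Relation.Binary.PropositionalEquality using (_≡_; refl; sym; cong; subst; module ≡-Reasoning)

0≤p*q : ∀ {p q} → 0ℚ ≤ p → 0ℚ ≤ q → 0ℚ ≤ p * q
0≤p*q {p} {q} 0≤p 0≤q = nonNegative⁻¹ (p * q) {{nonNeg*nonNeg⇒nonNeg p {{nonNegative 0≤p}} q {{nonNegative 0≤q}}}}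

p≤p*q : ∀ {p q} → 0ℚ ≤ p → 1ℚ ≤ q → p ≤ p * q
p≤p*q {p} {q} 0≤p 1≤q = subst (_≤ p * q) (*-identityʳ p) (*-monoˡ-≤-nonNeg p {{nonNegative 0≤p}} 1≤q)

p≤p+q : ∀ {p q} → 0ℚ ≤ q → p ≤ p + q
p≤p+q {p} {q} 0≤q = subst (_≤ p + q) (+-identityʳ p) (+-monoʳ-≤ p 0≤q)

-- _÷_ carries an irrelevant NonZero instance, so F and mean unfold to _÷⁺_ definitionally.
infixl 7 _÷⁺_

_÷⁺_ : (p q : ℚ) → .{{Positive q}} → ℚ
p ÷⁺ q = (p ÷ q) {{pos⇒nonZero q}}

p*[q÷⁺p]≡q : ∀ p q .{{_ : Positive p}} → p * (q ÷⁺ p) ≡ q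
p*[q÷⁺p]≡q p q = begin
  p * (q * 1/p) ≡⟨ solve 3 (λ p q ip → p :* (q :* ip) := q :* (p :* ip)) refl p q 1/p ⟩
  q * (p * 1/p) ≡⟨ cong (q *_) (*-inverseʳ p {{pos⇒nonZero p}}) ⟩
  q * 1ℚ        ≡⟨ *-identityʳ q ⟩
  q             ∎
  where open ≡-Reasoning
        open +-*-Solver
        1/p : ℚ
        1/p = (1/ p) {{pos⇒nonZero p}}

[x÷⁺p]*[p*q]≡x*q : ∀ x p q .{{_ : Positive p}} → (x ÷⁺ p) * (p * q) ≡ x * q
[x÷⁺p]*[p*q]≡x*q x p q = begin
  (x ÷⁺ p) * (p * q) ≡⟨ solve 3 (λ y p q → y :* (p :* q) := (p :* y) :* q) refl (x ÷⁺ p) p q ⟩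
  (p * (x ÷⁺ p)) * q ≡⟨ cong (_* q) (p*[q÷⁺p]≡q p x) ⟩
  x * q              ∎
  where open ≡-Reasoning
        open +-*-Solver

x*q≤y*p⇒x÷⁺p≤y÷⁺q : ∀ x y p q .{{_ : Positive p}} .{{_ : Positive q}} →
    x * q ≤ y * p → x ÷⁺ p ≤ y ÷⁺ q
x*q≤y*p⇒x÷⁺p≤y÷⁺q x y p q xq≤yp = *-cancelʳ-≤-pos (p * q) {{pos*pos⇒pos p q}} (begin
  (x ÷⁺ p) * (p * q) ≡⟨ [x÷⁺p]*[p*q]≡x*q x p q ⟩
  x * q              ≤⟨ xq≤yp ⟩
  y * p              ≡⟨ sym ([x÷⁺p]*[p*q]≡x*q y q p) ⟩
  (y ÷⁺ q) * (q * p) ≡⟨ cong ((y ÷⁺ q) *_) (*-comm q p) ⟩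
  (y ÷⁺ q) * (p * q) ∎)
  where open ≤-Reasoning

p*q≤r⇒q≤r÷⁺p : ∀ p q r .{{_ : Positive p}} → p * q ≤ r → q ≤ r ÷⁺ p
p*q≤r⇒q≤r÷⁺p p q r pq≤r = *-cancelˡ-≤-pos p (subst (p * q ≤_) (sym (p*[q÷⁺p]≡q p r)) pq≤r)

p*q≤r⇒p*[x÷⁺r]≤x÷⁺q : ∀ {x} p q r .{{_ : Positive q}} .{{_ : Positive r}} →
    0ℚ ≤ x → p * q ≤ r → p * (x ÷⁺ r) ≤ x ÷⁺ q
p*q≤r⇒p*[x÷⁺r]≤x÷⁺q {x} p q r 0≤x pq≤r = subst (_≤ x ÷⁺ q) (*-assoc p x ((1/ r) {{pos⇒nonZero r}}))
  (x*q≤y*p⇒x÷⁺p≤y÷⁺q (p * x) x r q (begin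
    p * x * q   ≡⟨ solve 3 (λ p x q → p :* x :* q := x :* (p :* q)) refl p x q ⟩
    x * (p * q) ≤⟨ *-monoˡ-≤-nonNeg x {{nonNegative 0≤x}} pq≤r ⟩
    x * r       ∎))
  where open ≤-Reasoning
        open +-*-Solver

r≤p*q⇒x÷⁺q≤p*[x÷⁺r] : ∀ {x} p q r .{{_ : Positive q}} .{{_ : Positive r}} →
    0ℚ ≤ x → r ≤ p * q → x ÷⁺ q ≤ p * (x ÷⁺ r)
r≤p*q⇒x÷⁺q≤p*[x÷⁺r] {x} p q r 0≤x r≤pq = subst (x ÷⁺ q ≤_) (*-assoc p x ((1/ r) {{pos⇒nonZero r}}))
  (x*q≤y*p⇒x÷⁺p≤y÷⁺q x (p * x) q r (begin
    x * r       ≤⟨ *-monoˡ-≤-nonNeg x {{nonNegative 0≤x}} r≤pq ⟩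
    x * (p * q) ≡⟨ solve 3 (λ p x q → x :* (p :* q) := p :* x :* q) refl p x q ⟩
    p * x * q   ∎))
  where open ≤-Reasoning
        open +-*-Solver

a*k+n*b≤[a+b]*n*k : ∀ {a b k n} → 0ℚ ≤ a → 0ℚ ≤ b → 1ℚ ≤ k → 1ℚ ≤ n →
    a * k + n * b ≤ (a + b) * n * k
a*k+n*b≤[a+b]*n*k {a} {b} {k} {n} 0≤a 0≤b 1≤k 1≤n = begin
  a * k + n * b         ≤⟨ +-mono-≤ (p≤p*q (0≤p*q 0≤a (1≤⇒0≤ 1≤k)) 1≤n) (p≤p*q (0≤p*q (1≤⇒0≤ 1≤n) 0≤b) 1≤k) ⟩
  a * k * n + n * b * k ≡⟨ solve 4 (λ a b k n → a :* k :* n :+ n :* b :* k := (a :+ b) :* n :* k) refl a b k n ⟩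
  (a + b) * n * k       ∎
  where open ≤-Reasoning
        open +-*-Solver
        1≤⇒0≤ : ∀ {p} → 1ℚ ≤ p → 0ℚ ≤ p
        1≤⇒0≤ = ≤-trans (*≤* (+≤+ z≤n))

1≤ℕ→ℚ : ∀ {k} → k ≥ 1 → 1ℚ ≤ ℕ→ℚ k
1≤ℕ→ℚ (s≤s z≤n) = *≤* (+≤+ (s≤s z≤n))

sumℚ-map-nonNeg : ∀ {A : Set} (f : A → ℚ) → (∀ x → 0ℚ ≤ f x) → ∀ xs → 0ℚ ≤ sumℚ (map f xs)
sumℚ-map-nonNeg f f≥0 []       = ≤-refl
sumℚ-map-nonNeg f f≥0 (x ∷ xs) = +-mono-≤ (f≥0 x) (sumℚ-map-nonNeg f f≥0 xs)

weight-nonNeg : ∀ {n} (w : Fin n → Fin n → ℚ) → (∀ u v → 0ℚ ≤ w u v) → ∀ C → 0ℚ ≤ weight w C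
weight-nonNeg w w≥0 C = sumℚ-map-nonNeg (uncurry w) (λ (u , v) → w≥0 u v) (cycleEdges C)

module _ (α β : ℚ) .{{_ : Positive α}} .{{_ : Positive β}}
         {n : ℕ} (w : Fin n → Fin n → ℚ) (w≥0 : ∀ u v → 0ℚ ≤ w u v) where

  private
    0≤α : 0ℚ ≤ α
    0≤α = <⇒≤ (positive⁻¹ α)

    0≤β : 0ℚ ≤ β
    0≤β = <⇒≤ (positive⁻¹ β)

    denominator-pos : ∀ (C : List⁺ (Fin n)) → Positive (α * ℕ→ℚ (length C) + ℕ→ℚ n * β)
    denominator-pos C@(_ ∷ _) = pos+nonNeg⇒pos (α * ℕ→ℚ (length C)) {{pos*pos⇒pos α (ℕ→ℚ (length C))}}
      (ℕ→ℚ n * β) {{nonNegative (0≤p*q (nonNegative⁻¹ (ℕ→ℚ n)) 0≤β)}}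

  α*F≤mean : ∀ C → α * F α β w C ≤ mean w C
  α*F≤mean C@(_ ∷ _) =
    p*q≤r⇒p*[x÷⁺r]≤x÷⁺q α (ℕ→ℚ (length C)) _ {{_}} {{denominator-pos C}}
    (weight-nonNeg w w≥0 C) (p≤p+q (0≤p*q (nonNegative⁻¹ (ℕ→ℚ n)) 0≤β))

  mean≤[α+β]*n*F : n ≥ 1 → ∀ C → mean w C ≤ (α + β) * ℕ→ℚ n * F α β w C
  mean≤[α+β]*n*F n≥1 C@(_ ∷ _) =
    r≤p*q⇒x÷⁺q≤p*[x÷⁺r] ((α + β) * ℕ→ℚ n) (ℕ→ℚ (length C)) _ {{_}} {{denominator-pos C}}
    (weight-nonNeg w w≥0 C) (a*k+n*b≤[a+b]*n*k 0≤α 0≤β (1≤ℕ→ℚ (s≤s z≤n)) (1≤ℕ→ℚ n≥1))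

  maxMean-approximates-F : n ≥ 1 → ∀ {E Cₖ C} → IsMaxMeanCycle E w Cₖ → IsSimpleCycle E C →
      F α β w C ≤ (α + β) ÷⁺ α * ℕ→ℚ n * F α β w Cₖ
  maxMean-approximates-F n≥1 {Cₖ = Cₖ} {C} (_ , Cₖ-max) C-simple =
    subst (F α β w C ≤_) reassociate (p*q≤r⇒q≤r÷⁺p α _ _ (begin
      α * F α β w C                ≤⟨ α*F≤mean C ⟩
      mean w C                     ≤⟨ Cₖ-max C C-simple ⟩
      mean w Cₖ                    ≤⟨ mean≤[α+β]*n*F n≥1 Cₖ ⟩
      (α + β) * ℕ→ℚ n * F α β w Cₖ ∎))
    where
    open ≤-Reasoning
    open +-*-Solver
    reassociate : (α + β) * ℕ→ℚ n * F α β w Cₖ ÷⁺ α ≡ (α + β) ÷⁺ α * ℕ→ℚ n * F α β w Cₖ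
    reassociate = solve 5 (λ a b m f ia → (a :+ b) :* m :* f :* ia := (a :+ b) :* ia :* m :* f)
      refl α β (ℕ→ℚ n) (F α β w Cₖ) ((1/ α) {{pos⇒nonZero α}})

lemma5p1 : (α β : ℚ) → .{{pα : Positive α}} → .{{pβ : Positive β}} →
    Σ ℚ (λ c → Σ ℕ (λ N₀ →
      ∀ (n : ℕ) → n ≥ N₀ →
      (E : Fin n → Fin n → Bool) → Loopless E →
      (w : Fin n → Fin n → ℚ) → (∀ u v → 0ℚ ≤ w u v) →
      (Cₖ : List⁺ (Fin n)) → IsMaxMeanCycle E w Cₖ →
      (C* : List⁺ (Fin n)) → IsOptimalMSIC α β E w C* →
      F α β w C* ≤ (c * ℕ→ℚ n) * F α β w Cₖ))
lemma5p1 α β = (α + β) ÷⁺ α , 1 , λ n n≥1 _ _ w w≥0 Cₖ Cₖ-maxMean C* (C*-simple , _) →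
  maxMean-approximates-F α β w w≥0 n≥1 Cₖ-maxMean C*-simple
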